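{- Let $G$ be a finite, simple, connected graph with at least one edge, on vertex set $\{1,\dots,N\}$, let $\nabla_G=\{\pm(\mathbf e_i-\mathbf e_j)\mid \{i,j\}\in\mathcal E(G)\}\subset\mathbb R^N$, and let $F$ be a nonempty proper face of $\nabla_G$. Then each connected component $H$ of $G_F$ is a maximal bipartite subgraph of the induced subgraph $G[\mathcal V(H)]$.
   Context: $\mathbf e_1,\dots,\mathbf e_N$ is the standard basis of $\mathbb R^N$. A subset $F\subseteq\nabla_G$ is a face of $\nabla_G$ if $F=\nabla_G\cap P'$ for a face $P'$ of the polytope $\operatorname{conv}(\nabla_G)$. For nonempty $X\subseteq\nabla_G$, $G_X$ is the undirected graph whose edges are the $\{i,j\}$ with $\mathbf e_i-\mathbf e_j\in X$ or $\mathbf e_j-\mathbf e_i\in X$, and whose vertices are the endpoints of these edges. A maximal bipartite subgraph is one that is maximal under inclusion among bipartite subgraphs; $G[V]$ denotes the induced subgraph on $V$.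
   Formalization: The faces of $\nabla_G$ are cut out by supporting hyperplanes of conv(∇_G) whose normal vector and level are rational rather than real. -}

module Defs where

open import Data.Nat using (ℕ; zero; suc)
open import Data.Fin using (Fin; zero; suc; _≟_)
open import Data.Bool using (Bool)
open import Data.Product using (Σ; ∃; ∃-syntax; _×_; _,_)
open import Data.Sum using (_⊎_)
open import Data.Rational using (ℚ; 0ℚ; 1ℚ; _+_; _*_; _-_; _≤_)
open import Relation.Nullary using (¬_; yes; no)
open import Relation.Binary.PropositionalEquality using (_≡_; _≢_)
open import Function.Bundles using (_⇔_)

record SimpleGraph (N : ℕ) : Set₁ where
  field
    Adj     : Fin N → Fin N → Set
    symm    : ∀ {u v} → Adj u v → Adj v u
    irrefl  : ∀ {u} → ¬ Adj u u
open SimpleGraph public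

data Walk {N : ℕ} (R : Fin N → Fin N → Set) : Fin N → Fin N → Set where
  here : ∀ {u} → Walk R u u
  step : ∀ {u w v} → R u w → Walk R w v → Walk R u v

Connected : ∀ {N} → SimpleGraph N → Set
Connected G = ∀ u v → Walk (Adj G) u v

HasEdge : ∀ {N} → SimpleGraph N → Set
HasEdge G = ∃[ u ] ∃[ v ] Adj G u v

record SubG (N : ℕ) : Set₁ where
  field
    V    : Fin N → Set
    E    : Fin N → Fin N → Set
    Esym : ∀ {u v} → E u v → E v u
    Eend : ∀ {u v} → E u v → V u × V v
open SubG public

_≤G_ : ∀ {N} → SubG N → SubG N → Set
H ≤G K = (∀ u → V H u → V K u) × (∀ u v → E H u v → E K u v)

Bipartite : ∀ {N} → SubG N → Set
Bipartite H = Σ (Fin _ → Bool) λ c → ∀ u v → E H u v → c u ≢ c v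

MaximalBipartiteSubgraph : ∀ {N} → SubG N → SubG N → Set₁
MaximalBipartiteSubgraph H X =
  H ≤G X × Bipartite H ×
  (∀ (K : SubG _) → H ≤G K → K ≤G X → Bipartite K → K ≤G H)

induced : ∀ {N} → SimpleGraph N → (Fin N → Set) → SubG N
induced G C = record
  { V = C
  ; E = λ u v → Adj G u v × C u × C v
  ; Esym = λ { (a , cu , cv) → symm G a , cv , cu }
  ; Eend = λ { (a , cu , cv) → cu , cv } }

IsComponent : ∀ {N} → SubG N → SubG N → Set
IsComponent X H =
  (∀ u → V H u → V X u) ×
  (∃[ u ] V H u) ×
  (∀ u v → V H u → V H v → Walk (E H) u v) ×
  (∀ u v → E H u v ⇔ (V H u × E X u v)) ×
  (∀ u v → V H u → E X u v → V H v)

basis : ∀ {N} → Fin N → Fin N → ℚ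
basis i k with i ≟ k
... | yes _ = 1ℚ
... | no  _ = 0ℚ

nvec : ∀ {N} → Fin N → Fin N → Fin N → ℚ
nvec i j k = basis i k - basis j k

sumFin : ∀ {n} → (Fin n → ℚ) → ℚ
sumFin {zero}  f = 0ℚ
sumFin {suc n} f = f zero + sumFin (λ k → f (suc k))

dot : ∀ {N} → (Fin N → ℚ) → (Fin N → ℚ) → ℚ
dot a x = sumFin (λ k → a k * x k)

-- A subset F of ∇_G is represented by the predicate on ordered pairs
-- (i , j) saying e_i - e_j ∈ F.  F is a face of ∇_G iff F = ∇_G ∩ P'
-- for a face P' = {x ∈ conv ∇_G | a·x = b} (a·x ≤ b on conv ∇_G)
-- of the polytope conv(∇_G).
IsFace : ∀ {N} → SimpleGraph N → (Fin N → Fin N → Set) → Set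
IsFace {N} G F =
  Σ (Fin N → ℚ) λ a → Σ ℚ λ b →
    (∀ i j → Adj G i j → dot a (nvec i j) ≤ b) ×
    (∀ i j → F i j ⇔ (Adj G i j × dot a (nvec i j) ≡ b))

Nonempty : ∀ {N} → (Fin N → Fin N → Set) → Set
Nonempty F = ∃[ i ] ∃[ j ] F i j

Proper : ∀ {N} → SimpleGraph N → (Fin N → Fin N → Set) → Set
Proper G F = ¬ (∀ i j → Adj G i j → F i j)

graphOf : ∀ {N} → (Fin N → Fin N → Set) → SubG N
graphOf F = record
  { V = λ u → ∃[ v ] (F u v ⊎ F v u)
  ; E = λ u v → F u v ⊎ F v u
  ; Esym = λ { (inj₁ x) → inj₂ x ; (inj₂ x) → inj₁ x }
  ; Eend = λ { {u} {v} (inj₁ x) → (v , inj₁ x) , (u , inj₂ x)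
             ; {u} {v} (inj₂ x) → (v , inj₂ x) , (u , inj₁ x) } }
  where open import Data.Sum using (inj₁; inj₂)

-- A face of ∇_G is cut out by a functional a with a_i − a_j ≤ b on every edge, F consisting of the
-- edges attaining b. As F is nonempty and proper, b > 0, so after rescaling b = 1: edges of G change
-- the height a by at most 1 and edges of G_F by exactly 1. Hence the parity of ⌊a_u⌋ properly
-- 2-colours G_F, and along walks in a component H heights change by integers. If K ⊇ H is a bipartite
-- subgraph of G[V(H)] and uv ∈ K, a proper colouring of K restricted to the connected graph H induces
-- the same partition as the floor parity, so a_u − a_v is an integer ≠ 0 with |a_u − a_v| ≤ 1; thus
-- a_u − a_v = ±1, uv ∈ G_F, and uv ∈ H.
module Submission where

open import Data.Bool.Base using (Bool; true; false; not; _xor_)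
open import Data.Bool.Properties using (not-involutive; not-injective; not-¬; ¬-not)
open import Data.Fin.Base using (Fin; zero; suc)
open import Data.Fin.Properties using (_≟_)
open import Data.Integer.Base as ℤ using (ℤ; +_; -[1+_]; 0ℤ; 1ℤ; -1ℤ)
import Data.Integer.Properties as ℤ
open import Data.Integer.DivMod using (div-pos-is-/ℕ; [n/ℕd]*d≤n; n<s[n/ℕd]*d)
open import Data.Integer.Solver using () renaming (module +-*-Solver to ℤ-Solver)
open import Data.Nat.Base as ℕ using (ℕ)
open import Data.Product using (∃-syntax; _×_; _,_; proj₁; proj₂)
open import Data.Product.Function.NonDependent.Propositional using (_×-⇔_)
open import Data.Rational.Base
open import Data.Rational.Literals using (fromℤ)
open import Data.Rational.Properties
  using ( toℚᵘ-injective; toℚᵘ-homo-+; <-cmp; ≤-antisym; ≤-<-trans; <-≤-trans; <-irrefl; <-trans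
        ; +-monoˡ-≤; +-monoˡ-<; +-inverseʳ; +-identityˡ; +-identityʳ; *-zeroʳ; *-identityˡ; *-identityʳ
        ; *-assoc; *-inverseˡ; *-inverseʳ; *-monoʳ-≤-nonNeg; neg-antimono-≤; neg-antimono-<
        ; pos⇒nonZero; pos⇒nonNeg; 1/pos⇒pos )
open import Data.Rational.Solver using () renaming (module +-*-Solver to ℚ-Solver)
import Data.Rational.Unnormalised.Base as ℚᵘ
import Data.Rational.Unnormalised.Properties as ℚᵘ
open import Data.Sum using (_⊎_; inj₁; inj₂)
open import Function.Base using (id; _∘_)
open import Function.Bundles using (_⇔_; mk⇔; Equivalence)
import Function.Properties.Equivalence as ⇔
open import Relation.Binary.Definitions using (tri<; tri≈; tri>)
open import Relation.Binary.PropositionalEquality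
open import Relation.Nullary using (yes; no; contradiction)

open import Defs

open Equivalence using (to; from)

fromℤ-+ : ∀ j k → fromℤ (j ℤ.+ k) ≡ fromℤ j + fromℤ k
fromℤ-+ j k = toℚᵘ-injective (ℚᵘ.≃-sym (ℚᵘ.≃-trans (toℚᵘ-homo-+ (fromℤ j) (fromℤ k))
  (ℚᵘ.*≡* (solve 2 (λ j k → (j :* con 1ℤ :+ k :* con 1ℤ) :* con 1ℤ := (j :+ k) :* con 1ℤ)
                   refl j k))))
  where open ℤ-Solver

fromℤ-suc : ∀ k → fromℤ (ℤ.suc k) ≡ fromℤ k + 1ℚ
fromℤ-suc k = trans (cong fromℤ (ℤ.+-comm 1ℤ k)) (fromℤ-+ k 1ℤ)

fromℤ-neg : ∀ k → fromℤ (ℤ.- k) ≡ - fromℤ k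
fromℤ-neg (+ 0)      = refl
fromℤ-neg ℤ.+[1+ n ] = refl
fromℤ-neg -[1+ n ]   = refl

fromℤ-cancel-≤ : ∀ {j k} → fromℤ j ≤ fromℤ k → j ℤ.≤ k
fromℤ-cancel-≤ {j} {k} (*≤* j≤k) = subst₂ ℤ._≤_ (ℤ.*-identityʳ j) (ℤ.*-identityʳ k) j≤k

fromℤ-cancel-< : ∀ {j k} → fromℤ j < fromℤ k → j ℤ.< k
fromℤ-cancel-< {j} {k} (*<* j<k) = subst₂ ℤ._<_ (ℤ.*-identityʳ j) (ℤ.*-identityʳ k) j<k

floor-lower : ∀ p → fromℤ ⌊ p ⌋ ≤ p
floor-lower (mkℚ n d _) = *≤* (subst₂ ℤ._≤_
  (cong (ℤ._* + ℕ.suc d) (sym (div-pos-is-/ℕ n (ℕ.suc d))))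
  (sym (ℤ.*-identityʳ n))
  ([n/ℕd]*d≤n n (ℕ.suc d)))

floor-upper : ∀ p → p < fromℤ (ℤ.suc ⌊ p ⌋)
floor-upper (mkℚ n d _) = *<* (subst₂ ℤ._<_
  (sym (ℤ.*-identityʳ n))
  (cong (λ q → ℤ.suc q ℤ.* + ℕ.suc d) (sym (div-pos-is-/ℕ n (ℕ.suc d))))
  (n<s[n/ℕd]*d n (ℕ.suc d)))

<-suc⇒≤ : ∀ {j k} → j ℤ.< ℤ.suc k → j ℤ.≤ k
<-suc⇒≤ {j} {k} j<1+k = subst (j ℤ.≤_) (ℤ.pred-suc k) (ℤ.i<j⇒i≤pred[j] j<1+k)

floor-unique : ∀ {p k} → fromℤ k ≤ p → p < fromℤ (ℤ.suc k) → ⌊ p ⌋ ≡ k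
floor-unique {p} k≤p p<1+k = ℤ.≤-antisym
  (<-suc⇒≤ (fromℤ-cancel-< (≤-<-trans (floor-lower p) p<1+k)))
  (<-suc⇒≤ (fromℤ-cancel-< (≤-<-trans k≤p (floor-upper p))))

floor-+1 : ∀ p → ⌊ p + 1ℚ ⌋ ≡ ℤ.suc ⌊ p ⌋
floor-+1 p = floor-unique
  (subst (_≤ p + 1ℚ) (sym (fromℤ-suc ⌊ p ⌋)) (+-monoˡ-≤ 1ℚ (floor-lower p)))
  (subst (p + 1ℚ <_) (sym (fromℤ-suc (ℤ.suc ⌊ p ⌋))) (+-monoˡ-< 1ℚ (floor-upper p)))

isOdd : ℤ → Bool
isOdd (+ 0)            = false
isOdd ℤ.+[1+ n ]       = not (isOdd (+ n))
isOdd -[1+ 0 ]         = true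
isOdd -[1+ ℕ.suc n ]   = not (isOdd -[1+ n ])

isOdd-suc : ∀ k → isOdd (ℤ.suc k) ≡ not (isOdd k)
isOdd-suc (+ n)            = refl
isOdd-suc -[1+ 0 ]         = refl
isOdd-suc -[1+ ℕ.suc n ]   = sym (not-involutive (isOdd -[1+ n ]))

floorParity : ℚ → Bool
floorParity x = isOdd ⌊ x ⌋

floorParity-+1 : ∀ x → floorParity (x + 1ℚ) ≡ not (floorParity x)
floorParity-+1 x = trans (cong isOdd (floor-+1 x)) (isOdd-suc ⌊ x ⌋)

difference-swap : ∀ x y → y - x ≡ - (x - y)
difference-swap = solve 2 (λ x y → y :- x := :- (x :- y)) refl
  where open ℚ-Solver

difference-telescope : ∀ x y z → x - z ≡ (x - y) + (y - z)
difference-telescope = solve 3 (λ x y z → x :- z := (x :- y) :+ (y :- z)) refl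
  where open ℚ-Solver

difference⇒≡+ : ∀ x y {d} → x - y ≡ d → x ≡ y + d
difference⇒≡+ x y refl = solve 2 (λ x y → x := y :+ (x :- y)) refl x y
  where open ℚ-Solver

DifferByInteger : ℚ → ℚ → Set
DifferByInteger x y = ∃[ k ] x - y ≡ fromℤ k

differByInteger-refl : ∀ x → DifferByInteger x x
differByInteger-refl x = 0ℤ , +-inverseʳ x

differByInteger-trans : ∀ x y z → DifferByInteger x y → DifferByInteger y z → DifferByInteger x z
differByInteger-trans x y z (j , x-y≡j) (k , y-z≡k) = j ℤ.+ k , (begin
  x - z                 ≡⟨ difference-telescope x y z ⟩
  (x - y) + (y - z)     ≡⟨ cong₂ _+_ x-y≡j y-z≡k ⟩
  fromℤ j + fromℤ k     ≡⟨ fromℤ-+ j k ⟨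
  fromℤ (j ℤ.+ k)       ∎)
  where open ≡-Reasoning

UnitStep : {A : Set} → (A → ℚ) → A → A → Set
UnitStep φ u w = φ u - φ w ≡ 1ℚ ⊎ φ w - φ u ≡ 1ℚ

unitStep⇒differByInteger : ∀ {A : Set} (φ : A → ℚ) {u w} → UnitStep φ u w →
                           DifferByInteger (φ u) (φ w)
unitStep⇒differByInteger φ         (inj₁ u-w≡1) = 1ℤ , u-w≡1
unitStep⇒differByInteger φ {u} {w} (inj₂ w-u≡1) =
  -1ℤ , trans (difference-swap (φ w) (φ u)) (cong -_ w-u≡1)

floorParity-flips : ∀ x y → x - y ≡ 1ℚ → floorParity x ≢ floorParity y
floorParity-flips x y x-y≡1 same = not-¬ same (begin
  floorParity x           ≡⟨ cong floorParity (difference⇒≡+ x y x-y≡1) ⟩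
  floorParity (y + 1ℚ)    ≡⟨ floorParity-+1 y ⟩
  not (floorParity y)     ∎)
  where open ≡-Reasoning

unitStep⇒floorParity-≢ : ∀ {A : Set} (φ : A → ℚ) {u w} → UnitStep φ u w →
                         floorParity (φ u) ≢ floorParity (φ w)
unitStep⇒floorParity-≢ φ {u} {w} (inj₁ u-w≡1) = floorParity-flips (φ u) (φ w) u-w≡1
unitStep⇒floorParity-≢ φ {u} {w} (inj₂ w-u≡1) = floorParity-flips (φ w) (φ u) w-u≡1 ∘ sym

walk-differByInteger : ∀ {N} {R : Fin N → Fin N → Set} (φ : Fin N → ℚ) →
  (∀ {u w} → R u w → UnitStep φ u w) → ∀ {u v} → Walk R u v → DifferByInteger (φ u) (φ v)
walk-differByInteger φ steps {u} here = differByInteger-refl (φ u)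
walk-differByInteger φ steps (step {u} {w} {v} r walk) = differByInteger-trans (φ u) (φ w) (φ v)
  (unitStep⇒differByInteger φ (steps r)) (walk-differByInteger φ steps walk)

ProperColouring : ∀ {N} → (Fin N → Fin N → Set) → (Fin N → Bool) → Set
ProperColouring R c = ∀ u w → R u w → c u ≢ c w

not-xor-not : ∀ x y → not x xor not y ≡ x xor y
not-xor-not true  y = refl
not-xor-not false y = not-involutive y

xor-cancelˡ : ∀ x {y z} → x xor y ≡ x xor z → y ≡ z
xor-cancelˡ false = id
xor-cancelˡ true  = not-injective

walk-xor-invariant : ∀ {N} {R : Fin N → Fin N → Set} {c c′ : Fin N → Bool} →
  ProperColouring R c → ProperColouring R c′ →
  ∀ {u v} → Walk R u v → c u xor c′ u ≡ c v xor c′ v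
walk-xor-invariant c-proper c′-proper here = refl
walk-xor-invariant {c = c} {c′} c-proper c′-proper (step {u} {w} {v} r walk) = begin
  c u xor c′ u              ≡⟨ cong₂ _xor_ (¬-not (c-proper u w r)) (¬-not (c′-proper u w r)) ⟩
  not (c w) xor not (c′ w)  ≡⟨ not-xor-not (c w) (c′ w) ⟩
  c w xor c′ w              ≡⟨ walk-xor-invariant c-proper c′-proper walk ⟩
  c v xor c′ v              ∎
  where open ≡-Reasoning

walk-colourings-agree : ∀ {N} {R : Fin N → Fin N → Set} {c c′ : Fin N → Bool} →
  ProperColouring R c → ProperColouring R c′ →
  ∀ {u v} → Walk R u v → c u ≡ c v → c′ u ≡ c′ v
walk-colourings-agree {c = c} {c′} c-proper c′-proper {u} {v} walk cu≡cv =
  xor-cancelˡ (c u) (trans (walk-xor-invariant c-proper c′-proper walk) (cong (_xor c′ v) (sym cu≡cv)))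

k≡±1 : ∀ {k} → k ℤ.≤ 1ℤ → ℤ.- k ℤ.≤ 1ℤ → k ≢ 0ℤ → k ≡ 1ℤ ⊎ k ≡ -1ℤ
k≡±1 {+ 0}                  _                    _                    k≢0 = contradiction refl k≢0
k≡±1 {+ 1}                  _                    _                    _   = inj₁ refl
k≡±1 {ℤ.+[1+ ℕ.suc n ]}     (ℤ.+≤+ (ℕ.s≤s ()))   _                    _
k≡±1 { -[1+ 0 ]}            _                    _                    _   = inj₂ refl
k≡±1 { -[1+ ℕ.suc n ]}      _                    (ℤ.+≤+ (ℕ.s≤s ()))   _

differentColours⇒unitStep : ∀ {N} {R : Fin N → Fin N → Set} (φ : Fin N → ℚ) {c : Fin N → Bool} →
  (∀ {u w} → R u w → UnitStep φ u w) → ProperColouring R c →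
  ∀ {u v} → Walk R u v → c u ≢ c v → φ u - φ v ≤ 1ℚ → φ v - φ u ≤ 1ℚ → UnitStep φ u v
differentColours⇒unitStep {R = R} φ steps c-proper {u} {v} walk cu≢cv u-v≤1 v-u≤1
  with walk-differByInteger φ steps walk
... | k , u-v≡k = fromUnit (k≡±1 k≤1 -k≤1 k≢0)
  where
  v-u≡-k : φ v - φ u ≡ fromℤ (ℤ.- k)
  v-u≡-k = trans (difference-swap (φ u) (φ v)) (trans (cong -_ u-v≡k) (sym (fromℤ-neg k)))

  k≤1 : k ℤ.≤ 1ℤ
  k≤1 = fromℤ-cancel-≤ (subst (_≤ 1ℚ) u-v≡k u-v≤1)

  -k≤1 : ℤ.- k ℤ.≤ 1ℤ
  -k≤1 = fromℤ-cancel-≤ (subst (_≤ 1ℚ) v-u≡-k v-u≤1)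

  floorParity-proper : ProperColouring R (floorParity ∘ φ)
  floorParity-proper _ _ r = unitStep⇒floorParity-≢ φ (steps r)

  k≢0 : k ≢ 0ℤ
  k≢0 refl = cu≢cv (walk-colourings-agree floorParity-proper c-proper walk
    (cong floorParity (trans (difference⇒≡+ (φ u) (φ v) u-v≡k) (+-identityʳ (φ v)))))

  fromUnit : k ≡ 1ℤ ⊎ k ≡ -1ℤ → UnitStep φ u v
  fromUnit (inj₁ refl) = inj₁ u-v≡k
  fromUnit (inj₂ refl) = inj₂ v-u≡-k

sumFin-cong : ∀ {n} {f g : Fin n → ℚ} → (∀ k → f k ≡ g k) → sumFin f ≡ sumFin g
sumFin-cong {ℕ.zero}  f≗g = refl
sumFin-cong {ℕ.suc n} f≗g = cong₂ _+_ (f≗g zero) (sumFin-cong (f≗g ∘ suc))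

sumFin-zero : ∀ n → sumFin {n} (λ _ → 0ℚ) ≡ 0ℚ
sumFin-zero ℕ.zero    = refl
sumFin-zero (ℕ.suc n) = cong (_+_ 0ℚ) (sumFin-zero n)

sumFin-distrib-difference : ∀ {n} (f g : Fin n → ℚ) →
                            sumFin (λ k → f k - g k) ≡ sumFin f - sumFin g
sumFin-distrib-difference {ℕ.zero}  f g = refl
sumFin-distrib-difference {ℕ.suc n} f g = begin
  (f zero - g zero) + sumFin (λ k → f (suc k) - g (suc k))
    ≡⟨ cong (_+_ (f zero - g zero)) (sumFin-distrib-difference (f ∘ suc) (g ∘ suc)) ⟩
  (f zero - g zero) + (sumFin (f ∘ suc) - sumFin (g ∘ suc))
    ≡⟨ solve 4 (λ a b c d → (a :- b) :+ (c :- d) := (a :+ c) :- (b :+ d)) refl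
               (f zero) (g zero) (sumFin (f ∘ suc)) (sumFin (g ∘ suc)) ⟩
  (f zero + sumFin (f ∘ suc)) - (g zero + sumFin (g ∘ suc))
    ∎
  where open ≡-Reasoning; open ℚ-Solver

basis-suc : ∀ {N} (i k : Fin N) → basis (suc i) (suc k) ≡ basis i k
basis-suc i k with i ≟ k
... | yes _ = refl
... | no  _ = refl

dot-basis : ∀ {N} (a : Fin N → ℚ) i → dot a (basis i) ≡ a i
dot-basis {ℕ.suc N} a zero = begin
  a zero * 1ℚ + sumFin (λ k → a (suc k) * 0ℚ)
    ≡⟨ cong₂ _+_ (*-identityʳ (a zero)) (sumFin-cong (*-zeroʳ ∘ a ∘ suc)) ⟩
  a zero + sumFin {N} (λ _ → 0ℚ)
    ≡⟨ cong (_+_ (a zero)) (sumFin-zero N) ⟩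
  a zero + 0ℚ
    ≡⟨ +-identityʳ (a zero) ⟩
  a zero
    ∎
  where open ≡-Reasoning
dot-basis {ℕ.suc N} a (suc i) = begin
  a zero * 0ℚ + dot (a ∘ suc) (basis (suc i) ∘ suc)
    ≡⟨ cong₂ _+_ (*-zeroʳ (a zero)) (sumFin-cong λ k → cong (a (suc k) *_) (basis-suc i k)) ⟩
  0ℚ + dot (a ∘ suc) (basis i)
    ≡⟨ +-identityˡ _ ⟩
  dot (a ∘ suc) (basis i)
    ≡⟨ dot-basis (a ∘ suc) i ⟩
  a (suc i)
    ∎
  where open ≡-Reasoning

dot-nvec : ∀ {N} (a : Fin N → ℚ) i j → dot a (nvec i j) ≡ a i - a j
dot-nvec a i j = begin
  dot a (nvec i j)
    ≡⟨ sumFin-cong (λ k → *-distribˡ-difference (a k) (basis i k) (basis j k)) ⟩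
  sumFin (λ k → a k * basis i k - a k * basis j k)
    ≡⟨ sumFin-distrib-difference (λ k → a k * basis i k) (λ k → a k * basis j k) ⟩
  dot a (basis i) - dot a (basis j)
    ≡⟨ cong₂ _-_ (dot-basis a i) (dot-basis a j) ⟩
  a i - a j
    ∎
  where
  open ≡-Reasoning
  *-distribˡ-difference : ∀ x y z → x * (y - z) ≡ x * y - x * z
  *-distribˡ-difference = solve 3 (λ x y z → x :* (y :- z) := x :* y :- x :* z) refl
    where open ℚ-Solver

face-offset-positive : ∀ {N} {G : SimpleGraph N} {F : Fin N → Fin N → Set} (a : Fin N → ℚ) b →
  (∀ {i j} → Adj G i j → a i - a j ≤ b) → (∀ i j → F i j ⇔ (Adj G i j × a i - a j ≡ b)) →
  Nonempty F → Proper G F → 0ℚ < b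
face-offset-positive {G = G} {F} a b a≤b F⇔ (i , j , Fij) proper with <-cmp 0ℚ b
... | tri< 0<b _ _ = 0<b
... | tri≈ _ refl _ = contradiction every-edge-in-F proper
  where
  every-edge-in-F : ∀ i j → Adj G i j → F i j
  every-edge-in-F i j adj = from (F⇔ i j) (adj , ≤-antisym (a≤b adj)
    (subst (0ℚ ≤_) (sym (difference-swap (a j) (a i))) (neg-antimono-≤ (a≤b (symm G adj)))))
... | tri> _ _ b<0 =
  contradiction (<-trans (<-≤-trans (neg-antimono-< b<0) -b≤b) b<0) (<-irrefl refl)
  where
  -b≤b : - b ≤ b
  -b≤b with to (F⇔ i j) Fij
  ... | adj , i-j≡b = subst (_≤ b) (trans (difference-swap (a i) (a j)) (cong -_ i-j≡b))
                            (a≤b (symm G adj))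

module _ (b : ℚ) .{{_ : Positive b}} where

  private instance
    b≢0 : NonZero b
    b≢0 = pos⇒nonZero b

    1/b≥0 : NonNegative (1/ b)
    1/b≥0 = pos⇒nonNeg (1/ b) {{1/pos⇒pos b}}

  ≤⇒*1/≤1 : ∀ {x} → x ≤ b → x * 1/ b ≤ 1ℚ
  ≤⇒*1/≤1 {x} x≤b = subst (x * 1/ b ≤_) (*-inverseʳ b) (*-monoʳ-≤-nonNeg (1/ b) x≤b)

  ≡⇔*1/≡1 : ∀ x → x ≡ b ⇔ x * 1/ b ≡ 1ℚ
  ≡⇔*1/≡1 x = mk⇔ (λ { refl → *-inverseʳ b }) λ x/b≡1 → begin
    x                 ≡⟨ *-identityʳ x ⟨
    x * 1ℚ            ≡⟨ cong (x *_) (*-inverseˡ b) ⟨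
    x * (1/ b * b)    ≡⟨ *-assoc x (1/ b) b ⟨
    x * 1/ b * b      ≡⟨ cong (_* b) x/b≡1 ⟩
    1ℚ * b            ≡⟨ *-identityˡ b ⟩
    b                 ∎
    where open ≡-Reasoning

record NormalisedFace {N} (G : SimpleGraph N) (F : Fin N → Fin N → Set) : Set where
  field
    height : Fin N → ℚ
    edge-≤ : ∀ {i j} → Adj G i j → height i - height j ≤ 1ℚ
    face-⇔ : ∀ i j → F i j ⇔ (Adj G i j × height i - height j ≡ 1ℚ)

normalise : ∀ {N} {G : SimpleGraph N} {F} →
            IsFace G F → Nonempty F → Proper G F → NormalisedFace G F
normalise {N} {G} {F} (a , b , dot≤b , F⇔dot≡b) nonempty proper =
  record { height = height ; edge-≤ = edge-≤ ; face-⇔ = face-⇔ }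
  where
  a≤b : ∀ {i j} → Adj G i j → a i - a j ≤ b
  a≤b {i} {j} adj = subst (_≤ b) (dot-nvec a i j) (dot≤b i j adj)

  F⇔a≡b : ∀ i j → F i j ⇔ (Adj G i j × a i - a j ≡ b)
  F⇔a≡b i j = subst (λ d → F i j ⇔ (Adj G i j × d ≡ b)) (dot-nvec a i j) (F⇔dot≡b i j)

  instance
    b>0 : Positive b
    b>0 = positive (face-offset-positive {G = G} a b a≤b F⇔a≡b nonempty proper)

    b≢0 : NonZero b
    b≢0 = pos⇒nonZero b

  height : Fin N → ℚ
  height i = a i * 1/ b

  height-difference : ∀ i j → height i - height j ≡ (a i - a j) * 1/ b
  height-difference i j =
    solve 3 (λ x y z → x :* z :- y :* z := (x :- y) :* z) refl (a i) (a j) (1/ b)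
    where open ℚ-Solver

  edge-≤ : ∀ {i j} → Adj G i j → height i - height j ≤ 1ℚ
  edge-≤ {i} {j} adj = subst (_≤ 1ℚ) (sym (height-difference i j)) (≤⇒*1/≤1 b (a≤b adj))

  face-⇔ : ∀ i j → F i j ⇔ (Adj G i j × height i - height j ≡ 1ℚ)
  face-⇔ i j = ⇔.trans (F⇔a≡b i j) (⇔.refl ×-⇔
    subst (λ d → a i - a j ≡ b ⇔ d ≡ 1ℚ) (sym (height-difference i j)) (≡⇔*1/≡1 b (a i - a j)))

module _ {N} {G : SimpleGraph N} {F : Fin N → Fin N → Set} (face : NormalisedFace G F) where
  open NormalisedFace face

  graphOf-adj : ∀ {u w} → E (graphOf F) u w → Adj G u w
  graphOf-adj (inj₁ Fuw) = proj₁ (to (face-⇔ _ _) Fuw)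
  graphOf-adj (inj₂ Fwu) = symm G (proj₁ (to (face-⇔ _ _) Fwu))

  graphOf-unitStep : ∀ {u w} → E (graphOf F) u w → UnitStep height u w
  graphOf-unitStep (inj₁ Fuw) = inj₁ (proj₂ (to (face-⇔ _ _) Fuw))
  graphOf-unitStep (inj₂ Fwu) = inj₂ (proj₂ (to (face-⇔ _ _) Fwu))

  unitStep⇒graphOf : ∀ {u w} → Adj G u w → UnitStep height u w → E (graphOf F) u w
  unitStep⇒graphOf adj (inj₁ u-w≡1) = inj₁ (from (face-⇔ _ _) (adj , u-w≡1))
  unitStep⇒graphOf adj (inj₂ w-u≡1) = inj₂ (from (face-⇔ _ _) (symm G adj , w-u≡1))

mainTheorem2 : (N : ℕ) (G : SimpleGraph N) → Connected G → HasEdge G →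
    (F : Fin N → Fin N → Set) → IsFace G F → Nonempty F → Proper G F →
    (H : SubG N) → IsComponent (graphOf F) H →
    MaximalBipartiteSubgraph H (induced G (V H))
mainTheorem2 N G _ _ F isFace nonempty proper H (_ , _ , walk , E-H⇔ , _) =
  H≤G[V] , (floorParity ∘ height , λ _ _ → unitStep⇒floorParity-≢ height ∘ H-unitStep) , maximal
  where
  face : NormalisedFace G F
  face = normalise isFace nonempty proper
  open NormalisedFace face

  H⊆G_F : ∀ {u w} → E H u w → E (graphOf F) u w
  H⊆G_F {u} {w} = proj₂ ∘ to (E-H⇔ u w)

  H-unitStep : ∀ {u w} → E H u w → UnitStep height u w
  H-unitStep = graphOf-unitStep face ∘ H⊆G_F

  H≤G[V] : H ≤G induced G (V H)
  H≤G[V] = (λ _ Hu → Hu) , λ _ _ e → graphOf-adj face (H⊆G_F e) , Eend H e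

  maximal : ∀ K → H ≤G K → K ≤G induced G (V H) → Bipartite K → K ≤G H
  maximal K (_ , H⊆K) (K⊆V , K⊆G[V]) (c , c-proper) = K⊆V , edge
    where
    edge : ∀ u v → E K u v → E H u v
    edge u v e with K⊆G[V] u v e
    ... | adj , Hu , Hv = from (E-H⇔ u v) (Hu , unitStep⇒graphOf face adj
      (differentColours⇒unitStep height H-unitStep (λ u w → c-proper u w ∘ H⊆K u w)
        (walk u v Hu Hv) (c-proper u v e) (edge-≤ adj) (edge-≤ (symm G adj))))
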